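{- Let $s>1$ and let $\Phi=(\phi_j)_{j=1}^{s+1}$ be a regular $s$-simplex for an $s$-dimensional non-isotropic space $V$ over $\mathbb{F}$. Then the vectors $\phi_1,\dots,\phi_{s+1}$ are minimally dependent: they are linearly dependent, but every proper subset of them is linearly independent.
   Context: $\mathbb{F}$ is a finite field of one of two kinds: (Case U) $\mathbb{F}=\mathbb{F}_{q^2}$ with involution $x^\sigma=x^q$, or (Case O) $\mathbb{F}=\mathbb{F}_q$ with $x^\sigma=x$; in both cases $q$ is odd. A non-isotropic space is a finite-dimensional $\mathbb{F}$-vector space with a non-degenerate Hermitian scalar product $\langle\cdot,\cdot\rangle$ (linear in the second argument, $\langle u,v\rangle=\langle v,u\rangle^\sigma$, non-degenerate). For a sequence $\Phi$ in $V$ with synthesis operator $x\mapsto\sum_jx_j\phi_j$ and adjoint $\Phi^\dagger v=(\langle\phi_j,v\rangle)_j$, $\Phi$ is a $c$-tight frame for $V$ if it spans $V$ and $\Phi\Phi^\dagger=cI$; it is an $(a,b,c)$-equiangular tight frame if moreover $\langle\phi_j,\phi_j\rangle=a$ for all $j$ and $\langle\phi_j,\phi_k\rangle\langle\phi_k,\phi_j\rangle=b$ for $j\neq k$. A regular $s$-simplex is a collection of $s+1$ vectors forming an $(a,b,c')$-equiangular tight frame (for some $a,b,c'$) for an $s$-dimensional non-isotropic space. -}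

module Defs where

open import Level using (Level; _⊔_; suc)
open import Algebra.Bundles using (CommutativeRing)
open import Data.Nat as ℕ using (ℕ)
open import Data.Fin as Fin using (Fin)
open import Data.Fin.Subset using (Subset; _∈_; _∉_)
open import Data.Product using (Σ; ∃; _×_; _,_)
open import Data.Sum using (_⊎_)
open import Relation.Nullary using (¬_)
open import Relation.Binary.PropositionalEquality using (_≡_)

record Field (c ℓ : Level) : Set (Level.suc (c ⊔ ℓ)) where
  field
    commutativeRing : CommutativeRing c ℓ
  open CommutativeRing commutativeRing public
  field
    1≉0     : ¬ (1# ≈ 0#)
    inverse : ∀ x → ¬ (x ≈ 0#) → ∃ λ y → x * y ≈ 1#

module FieldDefs {c ℓ} (F : Field c ℓ) where
  open Field F using (Carrier; _≈_; _+_; _*_; 0#; 1#)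

  pow : Carrier → ℕ → Carrier
  pow x ℕ.zero    = 1#
  pow x (ℕ.suc n) = x * pow x n

  HasCard : ℕ → Set (c ⊔ ℓ)
  HasCard n = Σ (Fin n → Carrier) λ f →
                (∀ i j → f i ≈ f j → i ≡ j) × (∀ x → ∃ λ i → f i ≈ x)

  -- The standing assumption: q odd, and either
  --  (Case U) |F| = q², σ x = x^q,  or  (Case O) |F| = q, σ x = x.
  AdmissibleFieldWithInvolution : (Carrier → Carrier) → Set (c ⊔ ℓ)
  AdmissibleFieldWithInvolution σ = Σ ℕ λ q → (∃ λ k → q ≡ ℕ.suc (2 ℕ.* k)) ×
      ((HasCard (q ℕ.* q) × (∀ x → σ x ≈ pow x q))
     ⊎ (HasCard q × (∀ x → σ x ≈ x)))

  sum : ∀ {n} → (Fin n → Carrier) → Carrier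
  sum {ℕ.zero}  f = 0#
  sum {ℕ.suc n} f = f Fin.zero + sum (λ i → f (Fin.suc i))

  -- the model of an s-dimensional F-vector space: F^s, with pointwise operations
  Vec : ℕ → Set c
  Vec s = Fin s → Carrier

  _≈ᵥ_ : ∀ {s} → Vec s → Vec s → Set ℓ
  u ≈ᵥ v = ∀ i → u i ≈ v i

  0ᵥ : ∀ {s} → Vec s
  0ᵥ i = 0#

  _+ᵥ_ : ∀ {s} → Vec s → Vec s → Vec s
  (u +ᵥ v) i = u i + v i

  _·_ : ∀ {s} → Carrier → Vec s → Vec s
  (a · v) i = a * v i

  synth : ∀ {s m} → (Fin m → Vec s) → (Fin m → Carrier) → Vec s
  synth Φ x i = sum λ j → x j * Φ j i

  record IsHermitianForm {s} (σ : Carrier → Carrier) (B : Vec s → Vec s → Carrier) : Set (c ⊔ ℓ) where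
    field
      cong       : ∀ {u u′ v v′} → u ≈ᵥ u′ → v ≈ᵥ v′ → B u v ≈ B u′ v′
      +-linearʳ  : ∀ u v w → B u (v +ᵥ w) ≈ B u v + B u w
      ·-linearʳ  : ∀ a u v → B u (a · v) ≈ a * B u v
      hermitian  : ∀ u v → B u v ≈ σ (B v u)
      nondegen   : ∀ u → (∀ v → B u v ≈ 0#) → u ≈ᵥ 0ᵥ

  module _ {s} (B : Vec s → Vec s → Carrier) where
    frameOp : ∀ {m} → (Fin m → Vec s) → Vec s → Vec s
    frameOp Φ v = synth Φ (λ j → B (Φ j) v)

    Spans : ∀ {m} → (Fin m → Vec s) → Set (c ⊔ ℓ)
    Spans Φ = ∀ v → ∃ λ x → synth Φ x ≈ᵥ v

    IsTightFrame : ∀ {m} → Carrier → (Fin m → Vec s) → Set (c ⊔ ℓ)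
    IsTightFrame a Φ = Spans Φ × (∀ v → frameOp Φ v ≈ᵥ (a · v))

    IsETF : ∀ {m} → Carrier → Carrier → Carrier → (Fin m → Vec s) → Set (c ⊔ ℓ)
    IsETF a b c′ Φ = IsTightFrame c′ Φ
                   × (∀ j → B (Φ j) (Φ j) ≈ a)
                   × (∀ j k → ¬ (j ≡ k) → B (Φ j) (Φ k) * B (Φ k) (Φ j) ≈ b)

    IsRegularSimplex : (Fin (ℕ.suc s) → Vec s) → Set (c ⊔ ℓ)
    IsRegularSimplex Φ = ∃ λ a → ∃ λ b → ∃ λ c′ → IsETF a b c′ Φ

  LinDependent : ∀ {s m} → (Fin m → Vec s) → Set (c ⊔ ℓ)
  LinDependent Φ = ∃ λ x → (∃ λ j → ¬ (x j ≈ 0#)) × (synth Φ x ≈ᵥ 0ᵥ)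

  LinIndependentOn : ∀ {s m} → (Fin m → Vec s) → Subset m → Set (c ⊔ ℓ)
  LinIndependentOn Φ S = ∀ x → (∀ j → j ∉ S → x j ≈ 0#) →
                         synth Φ x ≈ᵥ 0ᵥ → ∀ j → x j ≈ 0#

  ProperSubset : ∀ {m} → Subset m → Set
  ProperSubset S = ∃ λ j → j ∉ S

  MinimallyDependent : ∀ {s m} → (Fin m → Vec s) → Set (c ⊔ ℓ)
  MinimallyDependent Φ = LinDependent Φ × (∀ S → ProperSubset S → LinIndependentOn Φ S)

-- Over these finite fields x σ(x) is x^(q+1) or x², so it vanishes only at 0.  Hence b ≠ 0:
-- otherwise the φⱼ would be s+1 pairwise orthogonal vectors of common norm a in an s-dimensional
-- space, forcing a = 0 and a totally isotropic spanning family.  So every off-diagonal Gram entry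
-- ⟨φⱼ,φₖ⟩ is nonzero.  Tightness, Σⱼ ⟨φⱼ,φₖ⟩ φⱼ = c′ φₖ, makes column k of the Gram matrix minus
-- c′ eₖ a relation among the φⱼ which is nonzero at every j ≠ k; in particular the φⱼ are dependent.
-- Since s+1 vectors spanning an s-dimensional space have a one-dimensional space of relations, a
-- relation vanishing at j₀ is proportional to the column relation of some k ≠ j₀, which does not
-- vanish at j₀, so it is zero.
module Submission where

open import Defs
open import Level using (Level)
open import Data.Nat using (ℕ; suc; _<_)
open import Data.Fin using (Fin)

open import Data.Nat.Base using (zero)
open import Data.Fin.Base using (zero; suc; punchIn)
import Data.Fin.Properties as Finₚ
open import Data.Vec.Functional using (insertAt; tail; _∷_; [])
open import Data.Vec.Functional.Properties using (insertAt-lookup; insertAt-punchIn)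
open import Data.Product using (∃; ∃₂; _,_; proj₁; proj₂)
open import Data.Sum using (inj₁; inj₂)
open import Function using (_∘_)
open import Relation.Nullary using (¬_; yes; no; contradiction)
open import Relation.Binary.Definitions using (Decidable)
open import Relation.Binary.PropositionalEquality as ≡ using (_≡_; _≢_)
import Algebra.Properties.Ring as RingProperties
import Algebra.Properties.Semiring.Sum as SemiringSum

module LinearAlgebra {c ℓ} (F : Field c ℓ) where
  open Field F hiding (zero)
  open FieldDefs F
  open RingProperties ring using (-‿distribˡ-*)
  open import Relation.Binary.Reasoning.Setoid setoid
  private module ∑ = SemiringSum semiring

  x≉0∧x*y≈0⇒y≈0 : ∀ {x y} → ¬ x ≈ 0# → x * y ≈ 0# → y ≈ 0#
  x≉0∧x*y≈0⇒y≈0 {x} {y} x≉0 xy≈0 with inverse x x≉0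
  ... | x⁻¹ , xx⁻¹≈1 = begin
    y              ≈⟨ *-identityˡ y ⟨
    1# * y         ≈⟨ *-congʳ xx⁻¹≈1 ⟨
    (x * x⁻¹) * y  ≈⟨ *-congʳ (*-comm x x⁻¹) ⟩
    (x⁻¹ * x) * y  ≈⟨ *-assoc x⁻¹ x y ⟩
    x⁻¹ * (x * y)  ≈⟨ *-congˡ xy≈0 ⟩
    x⁻¹ * 0#       ≈⟨ zeroʳ x⁻¹ ⟩
    0#             ∎

  y≉0∧x*y≈0⇒x≈0 : ∀ {x y} → ¬ y ≈ 0# → x * y ≈ 0# → x ≈ 0#
  y≉0∧x*y≈0⇒x≈0 {x} {y} y≉0 xy≈0 = x≉0∧x*y≈0⇒y≈0 y≉0 (trans (*-comm y x) xy≈0)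

  sum≡∑ : ∀ {n} (f : Fin n → Carrier) → sum f ≡ ∑.sum f
  sum≡∑ {zero}  f = ≡.refl
  sum≡∑ {suc n} f = ≡.cong (f zero +_) (sum≡∑ (f ∘ suc))

  sum-cong : ∀ {n} {f g : Fin n → Carrier} → (∀ i → f i ≈ g i) → sum f ≈ sum g
  sum-cong {f = f} {g} f≈g rewrite sum≡∑ f | sum≡∑ g = ∑.sum-cong-≋ f≈g

  sum-zero : ∀ {n} {f : Fin n → Carrier} → (∀ i → f i ≈ 0#) → sum f ≈ 0#
  sum-zero {n} f≈0 = trans (sum-cong f≈0) (trans (reflexive (sum≡∑ {n} (λ _ → 0#))) (∑.sum-replicate-zero n))

  sum-+ : ∀ {n} (f g : Fin n → Carrier) → sum (λ i → f i + g i) ≈ sum f + sum g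
  sum-+ f g rewrite sum≡∑ (λ i → f i + g i) | sum≡∑ f | sum≡∑ g = ∑.∑-distrib-+ f g

  sum-*ˡ : ∀ {n} a (f : Fin n → Carrier) → sum (λ i → a * f i) ≈ a * sum f
  sum-*ˡ a f rewrite sum≡∑ (λ i → a * f i) | sum≡∑ f = sym (∑.*-distribˡ-sum a f)

  sum-*ʳ : ∀ {n} a (f : Fin n → Carrier) → sum (λ i → f i * a) ≈ sum f * a
  sum-*ʳ a f rewrite sum≡∑ (λ i → f i * a) | sum≡∑ f = sym (∑.*-distribʳ-sum a f)

  sum-comm : ∀ {m n} (f : Fin m → Fin n → Carrier) →
             sum (λ i → sum (f i)) ≈ sum (λ j → sum (λ i → f i j))
  sum-comm f = begin
    sum (λ i → sum (f i))                ≈⟨ sum-cong (λ i → reflexive (sum≡∑ (f i))) ⟩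
    sum (λ i → ∑.sum (f i))              ≡⟨ sum≡∑ (λ i → ∑.sum (f i)) ⟩
    ∑.sum (λ i → ∑.sum (f i))            ≈⟨ ∑.∑-comm f ⟩
    ∑.sum (λ j → ∑.sum (λ i → f i j))    ≡⟨ sum≡∑ (λ j → ∑.sum (λ i → f i j)) ⟨
    sum (λ j → ∑.sum (λ i → f i j))      ≈⟨ sum-cong (λ j → reflexive (sum≡∑ (λ i → f i j))) ⟨
    sum (λ j → sum (λ i → f i j))        ∎

  sum-remove : ∀ {n} (f : Fin (suc n) → Carrier) i → sum f ≈ f i + sum (f ∘ punchIn i)
  sum-remove f i rewrite sum≡∑ f | sum≡∑ (f ∘ punchIn i) = ∑.sum-remove f

  sum-single : ∀ {n} (f : Fin n → Carrier) i → (∀ j → j ≢ i → f j ≈ 0#) → sum f ≈ f i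
  sum-single {suc n} f i others≈0 = begin
    sum f                    ≈⟨ sum-remove f i ⟩
    f i + sum (f ∘ punchIn i) ≈⟨ +-congˡ (sum-zero (λ k → others≈0 _ (Finₚ.punchInᵢ≢i i k))) ⟩
    f i + 0#                 ≈⟨ +-identityʳ (f i) ⟩
    f i                      ∎

  basis : ∀ {n} → Fin n → Vec n
  basis k j with j Finₚ.≟ k
  ... | yes _ = 1#
  ... | no  _ = 0#

  basis-diag : ∀ {n} (k : Fin n) → basis k k ≈ 1#
  basis-diag k with k Finₚ.≟ k
  ... | yes _   = refl
  ... | no  k≢k = contradiction ≡.refl k≢k

  basis-offdiag : ∀ {n} {j k : Fin n} → j ≢ k → basis k j ≈ 0#
  basis-offdiag {j = j} {k} j≢k with j Finₚ.≟ k
  ... | yes j≡k = contradiction j≡k j≢k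
  ... | no  _   = refl

  synth-cong : ∀ {s m} (Φ : Fin m → Vec s) {x y} → x ≈ᵥ y → synth Φ x ≈ᵥ synth Φ y
  synth-cong Φ x≈y i = sum-cong (λ j → *-congʳ (x≈y j))

  synth-congˡ : ∀ {s m} {Φ Ψ : Fin m → Vec s} → (∀ j → Φ j ≈ᵥ Ψ j) → ∀ x → synth Φ x ≈ᵥ synth Ψ x
  synth-congˡ Φ≈Ψ x i = sum-cong (λ j → *-congˡ (Φ≈Ψ j i))

  synth-0ᵥ : ∀ {s m} (Φ : Fin m → Vec s) → synth Φ 0ᵥ ≈ᵥ 0ᵥ
  synth-0ᵥ Φ i = sum-zero (λ j → zeroˡ (Φ j i))

  synth-+ᵥ : ∀ {s m} (Φ : Fin m → Vec s) x y → synth Φ (x +ᵥ y) ≈ᵥ (synth Φ x +ᵥ synth Φ y)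
  synth-+ᵥ Φ x y i = trans (sum-cong (λ j → distribʳ (Φ j i) (x j) (y j))) (sum-+ (λ j → x j * Φ j i) (λ j → y j * Φ j i))

  synth-· : ∀ {s m} (Φ : Fin m → Vec s) a x → synth Φ (a · x) ≈ᵥ (a · synth Φ x)
  synth-· Φ a x i = trans (sum-cong (λ j → *-assoc a (x j) (Φ j i))) (sum-*ˡ a (λ j → x j * Φ j i))

  synth-basis : ∀ {s m} (Φ : Fin m → Vec s) k → synth Φ (basis k) ≈ᵥ Φ k
  synth-basis Φ k i = begin
    synth Φ (basis k) i   ≈⟨ sum-single _ k (λ j j≢k → trans (*-congʳ (basis-offdiag j≢k)) (zeroˡ (Φ j i))) ⟩
    basis k k * Φ k i     ≈⟨ *-congʳ (basis-diag k) ⟩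
    1# * Φ k i            ≈⟨ *-identityˡ (Φ k i) ⟩
    Φ k i                 ∎

  synth-of-basis : ∀ {n} (x : Vec n) → synth basis x ≈ᵥ x
  synth-of-basis x l = begin
    synth basis x l       ≈⟨ sum-single _ l (λ i i≢l → trans (*-congˡ (basis-offdiag (i≢l ∘ ≡.sym))) (zeroʳ (x i))) ⟩
    x l * basis l l       ≈⟨ *-congˡ (basis-diag l) ⟩
    x l * 1#              ≈⟨ *-identityʳ (x l) ⟩
    x l                   ∎

  synth-synth : ∀ {s m n} (Φ : Fin m → Vec s) (W : Fin n → Vec m) γ →
                synth Φ (synth W γ) ≈ᵥ synth (λ k → synth Φ (W k)) γ
  synth-synth Φ W γ i = begin
    sum (λ j → sum (λ k → γ k * W k j) * Φ j i)    ≈⟨ sum-cong (λ j → sym (sum-*ʳ (Φ j i) (λ k → γ k * W k j))) ⟩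
    sum (λ j → sum (λ k → γ k * W k j * Φ j i))    ≈⟨ sum-comm (λ j k → γ k * W k j * Φ j i) ⟩
    sum (λ k → sum (λ j → γ k * W k j * Φ j i))    ≈⟨ sum-cong (λ k → sum-cong (λ j → *-assoc (γ k) (W k j) (Φ j i))) ⟩
    sum (λ k → sum (λ j → γ k * (W k j * Φ j i)))  ≈⟨ sum-cong (λ k → sum-*ˡ (γ k) (λ j → W k j * Φ j i)) ⟩
    sum (λ k → γ k * synth Φ (W k) i)              ∎

  synth-insertAt : ∀ {s m} (Ψ : Fin (suc m) → Vec s) y j a →
                   synth Ψ (insertAt y j a) ≈ᵥ ((a · Ψ j) +ᵥ synth (Ψ ∘ punchIn j) y)
  synth-insertAt Ψ y j a i = trans (sum-remove (λ k → insertAt y j a k * Ψ k i) j)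
    (+-cong (*-congʳ (reflexive (insertAt-lookup y j a)))
            (sum-cong (λ k → *-congʳ (reflexive (insertAt-punchIn y j a k)))))

  synth-shear : ∀ {s m} (Ψ : Fin m → Vec s) (c : Fin m → Carrier) v y →
                synth (λ k → Ψ k +ᵥ (c k · v)) y ≈ᵥ (synth Ψ y +ᵥ (sum (λ k → y k * c k) · v))
  synth-shear Ψ c v y i = begin
    sum (λ k → y k * (Ψ k i + c k * v i))        ≈⟨ sum-cong (λ k → distribˡ (y k) (Ψ k i) (c k * v i)) ⟩
    sum (λ k → y k * Ψ k i + y k * (c k * v i))  ≈⟨ sum-+ (λ k → y k * Ψ k i) (λ k → y k * (c k * v i)) ⟩
    synth Ψ y i + sum (λ k → y k * (c k * v i))  ≈⟨ +-congˡ (sum-cong (λ k → *-assoc (y k) (c k) (v i))) ⟨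
    synth Ψ y i + sum (λ k → y k * c k * v i)    ≈⟨ +-congˡ (sum-*ʳ (v i) (λ k → y k * c k)) ⟩
    synth Ψ y i + sum (λ k → y k * c k) * v i    ∎

  -- Defs' Spans also takes the form B, which it ignores.
  Spanning : ∀ {s m} → (Fin m → Vec s) → Set (c Level.⊔ ℓ)
  Spanning Φ = ∀ v → ∃ λ x → synth Φ x ≈ᵥ v

  linDependent-pair⇒≈0ᵥ : ∀ {m} {x r : Vec m} {j} →
    LinDependent (x ∷ r ∷ []) → x j ≈ 0# → ¬ r j ≈ 0# → x ≈ᵥ 0ᵥ
  linDependent-pair⇒≈0ᵥ {x = x} {r} {j} (γ , (k , γk≉0) , γxr≈0) xj≈0 rj≉0 i =
    x≉0∧x*y≈0⇒y≈0 (γ₀≉0 γk≉0) (begin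
      γ zero * x i                      ≈⟨ +-identityʳ _ ⟨
      γ zero * x i + 0#                 ≈⟨ +-congˡ (trans (+-identityʳ _) (zeroˡ (r i))) ⟨
      γ zero * x i + (0# * r i + 0#)    ≈⟨ +-congˡ (+-congʳ (*-congʳ γ₁≈0)) ⟨
      synth (x ∷ r ∷ []) γ i            ≈⟨ γxr≈0 i ⟩
      0#                                ∎)
    where
      γ₁ = γ (suc zero)
      γ₁≈0 : γ₁ ≈ 0#
      γ₁≈0 = y≉0∧x*y≈0⇒x≈0 rj≉0 (begin
        γ₁ * r j                          ≈⟨ +-identityˡ _ ⟨
        0# + γ₁ * r j                     ≈⟨ +-congʳ (trans (*-congˡ xj≈0) (zeroʳ _)) ⟨
        γ zero * x j + γ₁ * r j           ≈⟨ +-congˡ (+-identityʳ _) ⟨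
        synth (x ∷ r ∷ []) γ j            ≈⟨ γxr≈0 j ⟩
        0#                                ∎)
      γ₀≉0 : ∀ {k} → ¬ γ k ≈ 0# → ¬ γ zero ≈ 0#
      γ₀≉0 {zero}     γ₀≉0 = γ₀≉0
      γ₀≉0 {suc zero} γ₁≉0 = contradiction γ₁≈0 γ₁≉0

  linDependent-dropHead : ∀ {s m} (Ψ : Fin m → Vec (suc s)) → (∀ k → Ψ k zero ≈ 0#) →
                          LinDependent (λ k → tail (Ψ k)) → LinDependent Ψ
  linDependent-dropHead Ψ heads≈0 (y , y≉0 , tails≈0) = y , y≉0 , λ where
    zero    → sum-zero (λ k → trans (*-congˡ (heads≈0 k)) (zeroʳ (y k)))
    (suc i) → tails≈0 i

  linDependent-unshear : ∀ {s m} (Ψ : Fin (suc m) → Vec s) j (c : Fin m → Carrier) →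
                         LinDependent (λ k → Ψ (punchIn j k) +ᵥ (c k · Ψ j)) → LinDependent Ψ
  linDependent-unshear Ψ j c (y , (k , yk≉0) , sheared≈0) =
    insertAt y j t , (punchIn j k , yk≉0 ∘ trans (reflexive (≡.sym (insertAt-punchIn y j t k)))) , λ i → begin
      synth Ψ (insertAt y j t) i                           ≈⟨ synth-insertAt Ψ y j t i ⟩
      t * Ψ j i + synth (Ψ ∘ punchIn j) y i                ≈⟨ +-comm _ _ ⟩
      synth (Ψ ∘ punchIn j) y i + t * Ψ j i                ≈⟨ synth-shear (Ψ ∘ punchIn j) c (Ψ j) y i ⟨
      synth (λ k → Ψ (punchIn j k) +ᵥ (c k · Ψ j)) y i     ≈⟨ sheared≈0 i ⟩
      0#                                                   ∎
    where t = sum (λ k → y k * c k)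

  module _ (_≟_ : Decidable _≈_) where

    pow≈0⇒≈0 : ∀ n {x} → pow x n ≈ 0# → x ≈ 0#
    pow≈0⇒≈0 zero    1≈0 = contradiction 1≈0 1≉0
    pow≈0⇒≈0 (suc n) {x} xⁿ⁺¹≈0 with x ≟ 0#
    ... | yes x≈0 = x≈0
    ... | no  x≉0 = pow≈0⇒≈0 n (x≉0∧x*y≈0⇒y≈0 x≉0 xⁿ⁺¹≈0)

    headClearingShear : ∀ {s m} (Ψ : Fin (suc m) → Vec (suc s)) →
      ∃₂ λ j (c : Fin m → Carrier) → ∀ k → (Ψ (punchIn j k) +ᵥ (c k · Ψ j)) zero ≈ 0#
    headClearingShear Ψ with Finₚ.all? (λ k → Ψ k zero ≟ 0#)
    ... | yes heads≈0 =
      zero , (λ _ → 0#) , λ k → trans (+-cong (heads≈0 (suc k)) (zeroˡ _)) (+-identityʳ 0#)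
    ... | no ¬heads≈0 with Finₚ.¬∀⟶∃¬ _ _ (λ k → Ψ k zero ≟ 0#) ¬heads≈0
    ...   | j , p≉0 with inverse (Ψ j zero) p≉0
    ...     | p⁻¹ , pp⁻¹≈1 = j , (λ k → - (Ψ (punchIn j k) zero * p⁻¹)) , λ k → cancel (Ψ (punchIn j k) zero)
      where
        p = Ψ j zero
        cancel : ∀ e → e + - (e * p⁻¹) * p ≈ 0#
        cancel e = begin
          e + - (e * p⁻¹) * p     ≈⟨ +-congˡ (-‿distribˡ-* (e * p⁻¹) p) ⟨
          e + - (e * p⁻¹ * p)     ≈⟨ +-congˡ (-‿cong (*-assoc e p⁻¹ p)) ⟩
          e + - (e * (p⁻¹ * p))   ≈⟨ +-congˡ (-‿cong (*-congˡ (trans (*-comm p⁻¹ p) pp⁻¹≈1))) ⟩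
          e + - (e * 1#)          ≈⟨ +-congˡ (-‿cong (*-identityʳ e)) ⟩
          e + - e                 ≈⟨ -‿inverseʳ e ⟩
          0#                      ∎

    s+1-linDependent : ∀ s (Ψ : Fin (suc s) → Vec s) → LinDependent Ψ
    s+1-linDependent zero    Ψ = (λ _ → 1#) , (zero , 1≉0) , λ ()
    s+1-linDependent (suc s) Ψ with headClearingShear Ψ
    ... | j , c , heads≈0 =
      linDependent-unshear Ψ j c (linDependent-dropHead sheared heads≈0 (s+1-linDependent s (λ k → tail (sheared k))))
      where sheared = λ k → Ψ (punchIn j k) +ᵥ (c k · Ψ j)

    relations-linDependent : ∀ {s} {Φ : Fin (suc s) → Vec s} → Spanning Φ →
      ∀ {x r} → synth Φ x ≈ᵥ 0ᵥ → synth Φ r ≈ᵥ 0ᵥ → LinDependent (x ∷ r ∷ [])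
    relations-linDependent {s} {Φ} spanning {x} {r} Φx≈0 Φr≈0 = pair (s+1-linDependent (suc s) W)
      where
        W : Fin (suc (suc s)) → Vec (suc s)
        W = x ∷ r ∷ λ i → proj₁ (spanning (basis i))

        images : ∀ k → synth Φ (W k) ≈ᵥ (0ᵥ ∷ 0ᵥ ∷ basis) k
        images zero          = Φx≈0
        images (suc zero)    = Φr≈0
        images (suc (suc i)) = proj₂ (spanning (basis i))

        pairIndex : Fin (suc (suc s)) → Fin 2
        pairIndex zero    = zero
        pairIndex (suc _) = suc zero

        pair : LinDependent W → LinDependent (x ∷ r ∷ [])
        pair (γ , (k , γk≉0) , γW≈0) = (γ zero ∷ γ (suc zero) ∷ []) , (pairIndex k , pair≉0 k γk≉0) , λ j → begin
            γ zero * x j + (γ (suc zero) * r j + 0#)   ≈⟨ +-congˡ (+-congˡ (sum-zero (λ i → trans (*-congʳ (rest≈0 i)) (zeroˡ _)))) ⟨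
            synth W γ j                               ≈⟨ γW≈0 j ⟩
            0#                                        ∎
          where
            -- Applying Φ to the relation γ among W turns it into a relation among the basis vectors.
            rest≈0 : ∀ i → γ (suc (suc i)) ≈ 0#
            rest≈0 i = sym (begin
              0#                                          ≈⟨ synth-0ᵥ Φ i ⟨
              synth Φ 0ᵥ i                                ≈⟨ synth-cong Φ γW≈0 i ⟨
              synth Φ (synth W γ) i                       ≈⟨ synth-synth Φ W γ i ⟩
              synth (λ k → synth Φ (W k)) γ i             ≈⟨ synth-congˡ images γ i ⟩
              γ zero * 0# + (γ (suc zero) * 0# + synth basis (λ i → γ (suc (suc i))) i)
                                                          ≈⟨ +-cong (zeroʳ _) (+-cong (zeroʳ _) (synth-of-basis (λ i → γ (suc (suc i))) i)) ⟩
              0# + (0# + γ (suc (suc i)))                 ≈⟨ trans (+-identityˡ _) (+-identityˡ _) ⟩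
              γ (suc (suc i))                             ∎)

            pair≉0 : ∀ k → ¬ γ k ≈ 0# → ¬ (γ zero ∷ γ (suc zero) ∷ []) (pairIndex k) ≈ 0#
            pair≉0 zero          γ₀≉0 = γ₀≉0
            pair≉0 (suc zero)    γ₁≉0 = γ₁≉0
            pair≉0 (suc (suc i)) γᵢ≉0 = contradiction (rest≈0 i) γᵢ≉0

  ≈0ᵥ⇒¬Spanning : ∀ {s m} {Φ : Fin m → Vec (suc s)} → (∀ j → Φ j ≈ᵥ 0ᵥ) → ¬ Spanning Φ
  ≈0ᵥ⇒¬Spanning {s} {Φ = Φ} Φ≈0 spanning with spanning (basis zero)
  ... | y , Φy≈e₀ = 1≉0 (begin
    1#                        ≈⟨ basis-diag {suc s} zero ⟨
    basis {suc s} zero zero   ≈⟨ Φy≈e₀ zero ⟨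
    synth Φ y zero            ≈⟨ sum-zero (λ j → trans (*-congˡ (Φ≈0 j zero)) (zeroʳ (y j))) ⟩
    0#                        ∎)

  module Sesquilinear {s} {σ : Carrier → Carrier} {B : Vec s → Vec s → Carrier} (H : IsHermitianForm σ B) where
    open IsHermitianForm H renaming (cong to B-cong)

    B-0ᵥʳ : ∀ u → B u 0ᵥ ≈ 0#
    B-0ᵥʳ u = begin
      B u 0ᵥ          ≈⟨ B-cong (λ _ → refl) (λ _ → zeroˡ 0#) ⟨
      B u (0# · 0ᵥ)   ≈⟨ ·-linearʳ 0# u 0ᵥ ⟩
      0# * B u 0ᵥ     ≈⟨ zeroˡ _ ⟩
      0#              ∎

    B-synthʳ : ∀ {m} u (Ψ : Fin m → Vec s) y → B u (synth Ψ y) ≈ sum (λ k → y k * B u (Ψ k))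
    B-synthʳ {zero}  u Ψ y = trans (B-cong (λ _ → refl) (λ _ → refl)) (B-0ᵥʳ u)
    B-synthʳ {suc m} u Ψ y = begin
      B u ((y zero · Ψ zero) +ᵥ synth (Ψ ∘ suc) (y ∘ suc))   ≈⟨ +-linearʳ u _ _ ⟩
      B u (y zero · Ψ zero) + B u (synth (Ψ ∘ suc) (y ∘ suc)) ≈⟨ +-cong (·-linearʳ _ _ _) (B-synthʳ u (Ψ ∘ suc) (y ∘ suc)) ⟩
      sum (λ k → y k * B u (Ψ k))                             ∎

    orthogonal-to-spanning⇒≈0ᵥ : ∀ {m} {Ψ : Fin m → Vec s} → Spanning Ψ →
                                 ∀ {u} → (∀ k → B u (Ψ k) ≈ 0#) → u ≈ᵥ 0ᵥ
    orthogonal-to-spanning⇒≈0ᵥ {Ψ = Ψ} spanning {u} u⊥Ψ = nondegen u λ v → begin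
      B u v                           ≈⟨ B-cong (λ _ → refl) (proj₂ (spanning v)) ⟨
      B u (synth Ψ (proj₁ (spanning v)))  ≈⟨ B-synthʳ u Ψ _ ⟩
      sum (λ k → proj₁ (spanning v) k * B u (Ψ k)) ≈⟨ sum-zero (λ k → trans (*-congˡ (u⊥Ψ k)) (zeroʳ _)) ⟩
      0#                              ∎

    orthogonal-family-norm≈0 : Decidable _≈_ → (Ψ : Fin (suc s) → Vec s) → ∀ {a} →
      (∀ j k → j ≢ k → B (Ψ j) (Ψ k) ≈ 0#) → (∀ j → B (Ψ j) (Ψ j) ≈ a) → a ≈ 0#
    orthogonal-family-norm≈0 _≟_ Ψ {a} orthogonal norm with s+1-linDependent _≟_ s Ψ
    ... | x , (j , xj≉0) , Ψx≈0 = x≉0∧x*y≈0⇒y≈0 xj≉0 (begin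
      x j * a                          ≈⟨ *-congˡ (norm j) ⟨
      x j * B (Ψ j) (Ψ j)              ≈⟨ sum-single _ j (λ k k≢j → trans (*-congˡ (orthogonal j k (k≢j ∘ ≡.sym))) (zeroʳ (x k))) ⟨
      sum (λ k → x k * B (Ψ j) (Ψ k))  ≈⟨ B-synthʳ (Ψ j) Ψ x ⟨
      B (Ψ j) (synth Ψ x)              ≈⟨ B-cong (λ _ → refl) Ψx≈0 ⟩
      B (Ψ j) 0ᵥ                       ≈⟨ B-0ᵥʳ (Ψ j) ⟩
      0#                               ∎)

  module RegularSimplex (_≟_ : Decidable _≈_) {σ : Carrier → Carrier}
    (norm≈0⇒≈0 : ∀ x → x * σ x ≈ 0# → x ≈ 0#)
    {t} {B : Vec (suc t) → Vec (suc t) → Carrier} (H : IsHermitianForm σ B)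
    {Φ : Fin (suc (suc t)) → Vec (suc t)} {a b c′ : Carrier}
    (spanning : Spanning Φ) (tight : ∀ v → frameOp B Φ v ≈ᵥ (c′ · v))
    (norm : ∀ j → B (Φ j) (Φ j) ≈ a) (angle : ∀ j k → j ≢ k → B (Φ j) (Φ k) * B (Φ k) (Φ j) ≈ b)
    where
    open IsHermitianForm H using (hermitian)
    open Sesquilinear H

    gram : Fin (suc (suc t)) → Fin (suc (suc t)) → Carrier
    gram j k = B (Φ j) (Φ k)

    b≈0⇒orthogonal : b ≈ 0# → ∀ j k → j ≢ k → gram j k ≈ 0#
    b≈0⇒orthogonal b≈0 j k j≢k =
      norm≈0⇒≈0 (gram j k) (trans (*-congˡ (sym (hermitian (Φ k) (Φ j)))) (trans (angle j k j≢k) b≈0))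

    b≉0 : ¬ b ≈ 0#
    b≉0 b≈0 = ≈0ᵥ⇒¬Spanning (λ j → orthogonal-to-spanning⇒≈0ᵥ spanning (gram≈0 j)) spanning
      where
        a≈0 : a ≈ 0#
        a≈0 = orthogonal-family-norm≈0 _≟_ Φ (b≈0⇒orthogonal b≈0) norm
        gram≈0 : ∀ j k → gram j k ≈ 0#
        gram≈0 j k with j Finₚ.≟ k
        ... | yes ≡.refl = trans (norm j) a≈0
        ... | no  j≢k    = b≈0⇒orthogonal b≈0 j k j≢k

    gram-offdiag≉0 : ∀ {j k} → j ≢ k → ¬ gram j k ≈ 0#
    gram-offdiag≉0 {j} {k} j≢k gram≈0 =
      b≉0 (trans (sym (angle j k j≢k)) (trans (*-congʳ gram≈0) (zeroˡ _)))

    relation : Fin (suc (suc t)) → Vec (suc (suc t))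
    relation k = (λ j → gram j k) +ᵥ ((- c′) · basis k)

    synth-relation : ∀ k → synth Φ (relation k) ≈ᵥ 0ᵥ
    synth-relation k i = begin
      synth Φ (relation k) i                                   ≈⟨ synth-+ᵥ Φ (λ j → gram j k) ((- c′) · basis k) i ⟩
      frameOp B Φ (Φ k) i + synth Φ ((- c′) · basis k) i        ≈⟨ +-cong (tight (Φ k) i) (synth-· Φ (- c′) (basis k) i) ⟩
      c′ * Φ k i + - c′ * synth Φ (basis k) i                   ≈⟨ +-congˡ (*-congˡ (synth-basis Φ k i)) ⟩
      c′ * Φ k i + - c′ * Φ k i                                 ≈⟨ distribʳ (Φ k i) c′ (- c′) ⟨
      (c′ + - c′) * Φ k i                                       ≈⟨ *-congʳ (-‿inverseʳ c′) ⟩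
      0# * Φ k i                                                ≈⟨ zeroˡ (Φ k i) ⟩
      0#                                                        ∎

    relation≉0 : ∀ {j k} → j ≢ k → ¬ relation k j ≈ 0#
    relation≉0 {j} {k} j≢k relation≈0 = gram-offdiag≉0 j≢k (begin
      gram j k                            ≈⟨ +-identityʳ _ ⟨
      gram j k + 0#                       ≈⟨ +-congˡ (trans (*-congˡ (basis-offdiag j≢k)) (zeroʳ (- c′))) ⟨
      gram j k + - c′ * basis k j         ≈⟨ relation≈0 ⟩
      0#                                  ∎)

    minimallyDependent : MinimallyDependent Φ
    minimallyDependent = (relation zero , (suc zero , relation≉0 λ ()) , synth-relation zero) , independent
      where
        independent : ∀ S → ProperSubset S → LinIndependentOn Φ S
        independent S (j₀ , j₀∉S) x outside≈0 Φx≈0 =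
          linDependent-pair⇒≈0ᵥ (relations-linDependent _≟_ {Φ = Φ} spanning {x} {relation k} Φx≈0 (synth-relation k))
                                (outside≈0 j₀ j₀∉S) (relation≉0 (Finₚ.punchInᵢ≢i j₀ zero ∘ ≡.sym))
          where k = punchIn j₀ zero

  HasCard⇒Decidable : ∀ {n} → HasCard n → Decidable _≈_
  HasCard⇒Decidable (f , f-injective , f-surjective) x y
    with f-surjective x | f-surjective y
  ... | i , fi≈x | j , fj≈y with i Finₚ.≟ j
  ...   | yes ≡.refl = yes (trans (sym fi≈x) fj≈y)
  ...   | no  i≢j    = no (λ x≈y → i≢j (f-injective i j (trans fi≈x (trans x≈y (sym fj≈y)))))

  admissible⇒decidable : ∀ {σ} → AdmissibleFieldWithInvolution σ → Decidable _≈_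
  admissible⇒decidable (_ , _ , inj₁ (card , _)) = HasCard⇒Decidable card
  admissible⇒decidable (_ , _ , inj₂ (card , _)) = HasCard⇒Decidable card

  admissible⇒norm≈0⇒≈0 : ∀ {σ} → AdmissibleFieldWithInvolution σ → ∀ x → x * σ x ≈ 0# → x ≈ 0#
  admissible⇒norm≈0⇒≈0 admissible@(q , _ , inj₁ (_ , σ≈pow)) x xσx≈0 =
    pow≈0⇒≈0 (admissible⇒decidable admissible) (suc q) (trans (*-congˡ (sym (σ≈pow x))) xσx≈0)
  admissible⇒norm≈0⇒≈0 admissible@(_ , _ , inj₂ (_ , σ≈id)) x xσx≈0 =
    pow≈0⇒≈0 (admissible⇒decidable admissible) 2 (trans (*-congˡ (trans (*-identityʳ x) (sym (σ≈id x)))) xσx≈0)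

lemma6p3 : ∀ {c ℓ : Level} (F : Field c ℓ) (σ : Field.Carrier F → Field.Carrier F) →
    FieldDefs.AdmissibleFieldWithInvolution F σ →
    (s : ℕ) → 1 < s →
    (B : FieldDefs.Vec F s → FieldDefs.Vec F s → Field.Carrier F) →
    FieldDefs.IsHermitianForm F σ B →
    (Φ : Fin (suc s) → FieldDefs.Vec F s) →
    FieldDefs.IsRegularSimplex F B Φ →
    FieldDefs.MinimallyDependent F Φ
lemma6p3 F σ admissible zero    () B H Φ rs
lemma6p3 F σ admissible (suc t) _  B H Φ (a , b , c′ , (spanning , tight) , norm , angle) =
  RegularSimplex.minimallyDependent (admissible⇒decidable admissible) (admissible⇒norm≈0⇒≈0 admissible)
                                    H spanning tight norm angle
  where open LinearAlgebra F
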